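{- Let $t$ be a positive integer with $\gcd(t,3)=1$. Then $D_3(H_t)$ is connected.
   Context: For a positive integer $t$, $H_t$ is the tree with vertices $a_1,a_2,a_3,u_0,u_1,\dots,u_t,b_1,b_2,b_3$ and edges $a_1a_2$, $a_2u_0$, $u_iu_{i+1}$ ($0\leqslant i<t$), $u_tb_2$, $b_2b_1$, $a_3u_0$, $b_3u_t$. The $3$-distance graph $D_3(G)$ has vertex set $V(G)$, two vertices being adjacent iff their distance in $G$ is exactly $3$. -}

module Defs where

open import Data.Nat using (ℕ; zero; suc; _<_)
open import Data.Fin using (Fin; toℕ)
import Data.Fin
open import Data.Sum using (_⊎_)
open import Data.Product using (_×_)
open import Relation.Nullary using (¬_)
open import Relation.Binary.PropositionalEquality using (_≡_)
open import Relation.Binary.Construct.Closure.ReflexiveTransitive using (Star)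

record Graph : Set₁ where
  field
    V   : Set
    Adj : V → V → Set
open Graph public

data Walk (G : Graph) : ℕ → V G → V G → Set where
  [] : ∀ {x} → Walk G zero x x
  _∷_ : ∀ {k x y z} → Adj G x y → Walk G k y z → Walk G (suc k) x z

Dist : (G : Graph) → V G → V G → ℕ → Set
Dist G x y k = Walk G k x y × (∀ m → m < k → ¬ Walk G m x y)

D₃ : Graph → Graph
D₃ G = record { V = V G ; Adj = λ x y → Dist G x y 3 }

Connected : Graph → Set
Connected G = ∀ x y → Star (Adj G) x y

data HV (t : ℕ) : Set where
  a₁ a₂ a₃ b₁ b₂ b₃ : HV t
  u : Fin (suc t) → HV t

data HEdge (t : ℕ) : HV t → HV t → Set where
  e-a₁a₂ : HEdge t a₁ a₂
  e-a₂u₀ : HEdge t a₂ (u Data.Fin.zero)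
  e-uu   : (i j : Fin (suc t)) → toℕ j ≡ suc (toℕ i) → HEdge t (u i) (u j)
  e-utb₂ : HEdge t (u (Data.Fin.fromℕ t)) b₂
  e-b₂b₁ : HEdge t b₂ b₁
  e-a₃u₀ : HEdge t a₃ (u Data.Fin.zero)
  e-b₃ut : HEdge t b₃ (u (Data.Fin.fromℕ t))

H : ℕ → Graph
H t = record { V = HV t ; Adj = λ x y → HEdge t x y ⊎ HEdge t y x }

-- Number the path a₁ a₂ u₀ … u_t b₂ b₁ by the positions 0 … t + 4. Two vertices of this
-- path whose positions differ by 3 are at distance 3, so within D₃ the path falls apart
-- into at most the three residue classes of positions mod 3. The leaf a₃ is at distance 3
-- from positions 0 and 4, joining the classes 0 and 1; the leaf b₃ is at distance 3 from
-- positions t and t + 4, joining the classes of t and t + 1, which brings in the third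
-- class exactly when 3 ∤ t. Distances are bounded below by 1-Lipschitz height functions.
module Submission where

open import Defs
open import Data.Nat using (ℕ; zero; suc; _≤_; _<_; _+_; _*_; _∸_; _/_; _%_; z≤n; s≤s)
open import Data.Nat.Properties
open import Data.Nat.DivMod using (m≡m%n+[m/n]*n; m%n<n)
open import Data.Nat.Divisibility using (_∣_; ∣-refl; ∣1⇒≡1; m%n≡0⇒n∣m)
open import Data.Nat.GCD using (gcd; gcd-greatest)
open import Data.Fin using (Fin; toℕ; fromℕ) renaming (zero to fzero; suc to fsuc)
open import Data.Fin.Properties using (toℕ-fromℕ; toℕ<n)
open import Data.Sum using (_⊎_; inj₁; inj₂; swap)
open import Data.Product using (_×_; _,_; proj₁; proj₂)
open import Relation.Nullary using (contradiction)
open import Relation.Binary.PropositionalEquality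
open import Relation.Binary.Construct.Closure.ReflexiveTransitive
  using (Star; ε; _◅_; _◅◅_; reverse)

Undirected : Graph → Set
Undirected G = ∀ {x y} → Adj G x y → Adj G y x

_∷ʳ_ : ∀ {G k x y z} → Walk G k x y → Adj G y z → Walk G (suc k) x z
[] ∷ʳ e = e ∷ []
(d ∷ w) ∷ʳ e = d ∷ (w ∷ʳ e)

Walk-reverse : ∀ {G} → Undirected G → ∀ {k x y} → Walk G k x y → Walk G k y x
Walk-reverse undirected [] = []
Walk-reverse undirected (e ∷ w) = Walk-reverse undirected w ∷ʳ undirected e

Dist-sym : ∀ {G} → Undirected G → ∀ {k x y} → Dist G x y k → Dist G y x k
Dist-sym undirected (w , shortest) =
  Walk-reverse undirected w , λ m m<k w′ → shortest m m<k (Walk-reverse undirected w′)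

D₃-undirected : ∀ {G} → Undirected G → Undirected (D₃ G)
D₃-undirected undirected = Dist-sym undirected

connected-from : ∀ {G} → Undirected G → (r : V G) → (∀ x → Star (Adj G) r x) → Connected G
connected-from undirected r reach x y = reverse undirected (reach x) ◅◅ reach y

Lipschitz : (G : Graph) → (V G → ℕ) → Set
Lipschitz G f = ∀ {x y} → Adj G x y → f y ≤ suc (f x)

walk-length-bound : ∀ {G f} → Lipschitz G f → ∀ {m x y} → Walk G m x y → f y ≤ m + f x
walk-length-bound lip [] = ≤-refl
walk-length-bound {f = f} lip {suc m} {x} (e ∷ w) = begin
  _             ≤⟨ walk-length-bound lip w ⟩
  m + _         ≤⟨ +-monoʳ-≤ m (lip e) ⟩
  m + suc (f x) ≡⟨ +-suc m (f x) ⟩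
  suc m + f x   ∎
  where open ≤-Reasoning

Dist-from-height : ∀ {G f} → Lipschitz G f → ∀ {k x y} →
                   Walk G k x y → f y ≡ k + f x → Dist G x y k
Dist-from-height {f = f} lip {x = x} w rise = w , λ m m<k w′ →
  <⇒≱ (+-monoˡ-< (f x) m<k) (subst (_≤ m + f x) rise (walk-length-bound lip w′))

divisor-of-coprime : ∀ {m n} → gcd m n ≡ 1 → n ∣ m → n ≡ 1
divisor-of-coprime coprime n∣m = ∣1⇒≡1 (subst (_ ∣_) coprime (gcd-greatest n∣m ∣-refl))

coprime-to-3-residue : ∀ t → gcd t 3 ≡ 1 → t % 3 ≡ 1 ⊎ t % 3 ≡ 2
coprime-to-3-residue t coprime with t % 3 in eq | m%n<n t 3
... | 0 | _ = contradiction (divisor-of-coprime coprime (m%n≡0⇒n∣m t 3 eq)) λ ()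
... | 1 | _ = inj₁ refl
... | 2 | _ = inj₂ refl
... | suc (suc (suc _)) | s≤s (s≤s (s≤s ()))

m≡[m/3]*3+m%3 : ∀ m → m ≡ m / 3 * 3 + m % 3
m≡[m/3]*3+m%3 m = trans (m≡m%n+[m/n]*n m 3) (+-comm (m % 3) _)

clamp : (t k : ℕ) → Fin (suc t)
clamp t zero = fzero
clamp zero (suc k) = fzero
clamp (suc t) (suc k) = fsuc (clamp t k)

toℕ-clamp : ∀ {t k} → k ≤ t → toℕ (clamp t k) ≡ k
toℕ-clamp {k = zero} _ = refl
toℕ-clamp {suc t} {suc k} (s≤s k≤t) = cong suc (toℕ-clamp k≤t)

clamp-toℕ : ∀ t (i : Fin (suc t)) → clamp t (toℕ i) ≡ i
clamp-toℕ t fzero = refl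
clamp-toℕ (suc t) (fsuc i) = cong fsuc (clamp-toℕ t i)

clamp-self : ∀ t → clamp t t ≡ fromℕ t
clamp-self zero = refl
clamp-self (suc t) = cong fsuc (clamp-self t)

module Caterpillar (t : ℕ) where

  H-undirected : Undirected (H t)
  H-undirected = swap

  _~_ : HV t → HV t → Set
  _~_ = Star (Adj (D₃ (H t)))

  ~-sym : ∀ {x y} → x ~ y → y ~ x
  ~-sym = reverse (D₃-undirected H-undirected)

  -- The path a₁ … b₁ is numbered 0 … t + 4, while a₃ sits at height 1 + α and b₃ at
  -- height 1 + t + β, both within 1 of their neighbours as long as α, β ≤ 2.
  height : ℕ → ℕ → HV t → ℕ
  height α β a₁ = 0
  height α β a₂ = 1
  height α β a₃ = suc α
  height α β (u i) = 2 + toℕ i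
  height α β b₂ = 3 + t
  height α β b₁ = 4 + t
  height α β b₃ = β + suc t

  height-HEdge : ∀ {α β} → α ≤ 2 → β ≤ 2 → ∀ {x y} → HEdge t x y →
                 height α β y ≤ suc (height α β x) × height α β x ≤ suc (height α β y)
  height-HEdge α≤2 β≤2 e-a₁a₂ = s≤s z≤n , z≤n
  height-HEdge α≤2 β≤2 e-a₂u₀ = ≤-refl , s≤s z≤n
  height-HEdge α≤2 β≤2 (e-uu i j j≡1+i) rewrite j≡1+i = ≤-refl , m≤n+m (2 + toℕ i) 2
  height-HEdge α≤2 β≤2 e-utb₂ rewrite toℕ-fromℕ t = ≤-refl , m≤n+m (2 + t) 2
  height-HEdge α≤2 β≤2 e-b₂b₁ = ≤-refl , m≤n+m (3 + t) 2
  height-HEdge α≤2 β≤2 e-a₃u₀ = s≤s (s≤s z≤n) , s≤s α≤2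
  height-HEdge {β = β} α≤2 β≤2 e-b₃ut rewrite toℕ-fromℕ t =
    s≤s (m≤n+m (suc t) β) , +-monoˡ-≤ (suc t) β≤2

  height-lipschitz : ∀ {α β} → α ≤ 2 → β ≤ 2 → Lipschitz (H t) (height α β)
  height-lipschitz α≤2 β≤2 (inj₁ e) = proj₁ (height-HEdge α≤2 β≤2 e)
  height-lipschitz α≤2 β≤2 (inj₂ e) = proj₂ (height-HEdge α≤2 β≤2 e)

  linked-by-height : ∀ α β → α ≤ 2 → β ≤ 2 → ∀ {x y} →
                     Walk (H t) 3 x y → height α β y ≡ 3 + height α β x → x ~ y
  linked-by-height α β α≤2 β≤2 w rise =
    Dist-from-height (height-lipschitz α≤2 β≤2) w rise ◅ ε

  beyond-t : ℕ → Fin (suc t) → HV t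
  beyond-t 0 i = u i
  beyond-t 1 _ = b₂
  beyond-t (suc (suc _)) _ = b₁

  -- Positions past t + 4 are junk (they all name b₁).
  spine : ℕ → HV t
  spine 0 = a₁
  spine 1 = a₂
  spine (suc (suc k)) = beyond-t (k ∸ t) (clamp t k)

  spine-u : ∀ {k} → k ≤ t → spine (2 + k) ≡ u (clamp t k)
  spine-u k≤t rewrite m≤n⇒m∸n≡0 k≤t = refl

  spine-u-last : spine (2 + t) ≡ u (fromℕ t)
  spine-u-last = trans (spine-u ≤-refl) (cong u (clamp-self t))

  spine-b₂ : spine (3 + t) ≡ b₂
  spine-b₂ rewrite m+n∸n≡m 1 t = refl

  spine-b₁ : spine (4 + t) ≡ b₁
  spine-b₁ rewrite m+n∸n≡m 2 t = refl

  spine-edge : ∀ p → p < 4 + t → Adj (H t) (spine p) (spine (suc p))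
  spine-edge 0 _ = inj₁ e-a₁a₂
  spine-edge 1 _ = subst (Adj (H t) a₂) (sym (spine-u z≤n)) (inj₁ e-a₂u₀)
  spine-edge (suc (suc k)) (s≤s (s≤s k<2+t)) with m<1+n⇒m<n∨m≡n k<2+t
  ... | inj₂ refl = subst₂ (Adj (H t)) (sym spine-b₂) (sym spine-b₁) (inj₁ e-b₂b₁)
  ... | inj₁ k<1+t with m<1+n⇒m<n∨m≡n k<1+t
  ...   | inj₂ refl = subst₂ (Adj (H t)) (sym spine-u-last) (sym spine-b₂) (inj₁ e-utb₂)
  ...   | inj₁ k<t = subst₂ (Adj (H t)) (sym (spine-u (<⇒≤ k<t))) (sym (spine-u k<t))
                       (inj₁ (e-uu _ _ (trans (toℕ-clamp k<t) (cong suc (sym (toℕ-clamp (<⇒≤ k<t)))))))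

  height-spine : ∀ α β p → p ≤ 4 + t → height α β (spine p) ≡ p
  height-spine α β 0 _ = refl
  height-spine α β 1 _ = refl
  height-spine α β (suc (suc k)) (s≤s (s≤s k≤2+t)) with m≤n⇒m<n∨m≡n k≤2+t
  ... | inj₂ refl = cong (height α β) spine-b₁
  ... | inj₁ (s≤s k≤1+t) with m≤n⇒m<n∨m≡n k≤1+t
  ...   | inj₂ refl = cong (height α β) spine-b₂
  ...   | inj₁ (s≤s k≤t) = trans (cong (height α β) (spine-u k≤t)) (cong (2 +_) (toℕ-clamp k≤t))

  spine-step : ∀ p → 3 + p ≤ 4 + t → spine p ~ spine (3 + p)
  spine-step p 3+p≤4+t = linked-by-height 0 0 z≤n z≤n walk rise
    where
    walk : Walk (H t) 3 (spine p) (spine (3 + p))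
    walk = spine-edge p (≤-trans (m≤n+m (suc p) 2) 3+p≤4+t)
         ∷ (spine-edge (suc p) (≤-trans (m≤n+m (2 + p) 1) 3+p≤4+t)
         ∷ (spine-edge (2 + p) 3+p≤4+t ∷ []))
    rise : height 0 0 (spine (3 + p)) ≡ 3 + height 0 0 (spine p)
    rise = trans (height-spine 0 0 (3 + p) 3+p≤4+t)
                 (cong (3 +_) (sym (height-spine 0 0 p (≤-trans (m≤n+m p 3) 3+p≤4+t))))

  spine-shift : ∀ q r → q * 3 + r ≤ 4 + t → spine r ~ spine (q * 3 + r)
  spine-shift zero r _ = ε
  spine-shift (suc q) r h = spine-shift q r (≤-trans (m≤n+m _ 3) h) ◅◅ spine-step (q * 3 + r) h

  spine-residue : ∀ p → p ≤ 4 + t → spine (p % 3) ~ spine p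
  spine-residue p p≤4+t = subst (λ n → spine (p % 3) ~ spine n) (sym (m≡[m/3]*3+m%3 p))
    (spine-shift (p / 3) (p % 3) (subst (_≤ 4 + t) (m≡[m/3]*3+m%3 p) p≤4+t))

  a₁~a₃ : a₁ ~ a₃
  a₁~a₃ = linked-by-height 2 0 ≤-refl z≤n (inj₁ e-a₁a₂ ∷ (inj₁ e-a₂u₀ ∷ (inj₂ e-a₃u₀ ∷ []))) refl

  a₃~spine4 : a₃ ~ spine 4
  a₃~spine4 = linked-by-height 0 0 z≤n z≤n
    (subst (Adj (H t) a₃) (sym (spine-u z≤n)) (inj₁ e-a₃u₀)
      ∷ (spine-edge 2 (m≤m+n 3 (suc t)) ∷ (spine-edge 3 (m≤m+n 4 t) ∷ [])))
    (height-spine 0 0 4 (m≤m+n 4 t))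

  spine~b₃ : spine t ~ b₃
  spine~b₃ = linked-by-height 0 2 z≤n ≤-refl
    (spine-edge t (m≤n+m (suc t) 3) ∷ (spine-edge (suc t) (m≤n+m (2 + t) 2)
      ∷ (subst (λ x → Adj (H t) x b₃) (sym spine-u-last) (inj₂ e-b₃ut) ∷ [])))
    (cong (3 +_) (sym (height-spine 0 2 t (m≤n+m t 4))))

  b₃~spine : b₃ ~ spine (4 + t)
  b₃~spine = subst (b₃ ~_) (sym spine-b₁)
    (linked-by-height 0 0 z≤n z≤n (inj₁ e-b₃ut ∷ (inj₁ e-utb₂ ∷ (inj₁ e-b₂b₁ ∷ []))) refl)

  a₃-link : spine 0 ~ spine 1
  a₃-link = a₁~a₃ ◅◅ a₃~spine4 ◅◅ ~-sym (spine-shift 1 1 (m≤m+n 4 t))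

  b₃-link : spine (t % 3) ~ spine (suc (t % 3))
  b₃-link =
    subst (λ n → spine r ~ spine n) (sym t≡) (spine-shift q r (subst (_≤ 4 + t) t≡ (m≤n+m t 4)))
    ◅◅ spine~b₃ ◅◅ b₃~spine
    ◅◅ subst (λ n → spine n ~ spine (suc r)) 4+t≡ (~-sym (spine-shift (suc q) (suc r) (≤-reflexive 4+t≡)))
    where
    q = t / 3
    r = t % 3
    t≡ : t ≡ q * 3 + r
    t≡ = m≡[m/3]*3+m%3 t
    4+t≡ : suc q * 3 + suc r ≡ 4 + t
    4+t≡ = trans (cong (3 +_) (+-suc (q * 3) r)) (cong (4 +_) (sym t≡))

  spine0~spine2 : t % 3 ≡ 1 ⊎ t % 3 ≡ 2 → spine 0 ~ spine 2
  spine0~spine2 (inj₁ r≡1) = a₃-link ◅◅ subst (λ r → spine r ~ spine (suc r)) r≡1 b₃-link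
  spine0~spine2 (inj₂ r≡2) =
    spine-step 0 (m≤m+n 3 (suc t)) ◅◅ ~-sym (subst (λ r → spine r ~ spine (suc r)) r≡2 b₃-link)

  spine-rooted : t % 3 ≡ 1 ⊎ t % 3 ≡ 2 → ∀ p → p ≤ 4 + t → spine 0 ~ spine p
  spine-rooted residue p p≤4+t = residue-rooted (p % 3) (m%n<n p 3) ◅◅ spine-residue p p≤4+t
    where
    residue-rooted : ∀ r → r < 3 → spine 0 ~ spine r
    residue-rooted 0 _ = ε
    residue-rooted 1 _ = a₃-link
    residue-rooted 2 _ = spine0~spine2 residue
    residue-rooted (suc (suc (suc _))) (s≤s (s≤s (s≤s ())))

  a₁-rooted : t % 3 ≡ 1 ⊎ t % 3 ≡ 2 → ∀ x → a₁ ~ x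
  a₁-rooted residue a₁ = ε
  a₁-rooted residue a₂ = spine-rooted residue 1 (m≤m+n 1 (3 + t))
  a₁-rooted residue a₃ = a₁~a₃
  a₁-rooted residue (u i) = subst (a₁ ~_) (trans (spine-u i≤t) (cong u (clamp-toℕ t i)))
    (spine-rooted residue (2 + toℕ i) (+-monoʳ-≤ 2 (≤-trans i≤t (m≤n+m t 2))))
    where
    i≤t : toℕ i ≤ t
    i≤t = ≤-pred (toℕ<n i)
  a₁-rooted residue b₂ = subst (a₁ ~_) spine-b₂ (spine-rooted residue (3 + t) (n≤1+n (3 + t)))
  a₁-rooted residue b₁ = subst (a₁ ~_) spine-b₁ (spine-rooted residue (4 + t) ≤-refl)
  a₁-rooted residue b₃ = spine-rooted residue (4 + t) ≤-refl ◅◅ ~-sym b₃~spine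

lemma2p4 : (t : ℕ) → 1 ≤ t → gcd t 3 ≡ 1 → Connected (D₃ (H t))
lemma2p4 t _ coprime =
  connected-from (D₃-undirected H-undirected) a₁ (a₁-rooted (coprime-to-3-residue t coprime))
  where open Caterpillar t
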